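{- Let $p$ be a prime, let $x, y \in \mathbb{Z}_p$, and let $k \ge 0$ be an integer. (i) If $|x|_p \le p^{ -k}$, then $|\varphi(x)| \le p^{ -k}$. (ii) If $|\varphi(x)| \le p^{ -k}$, then $|x|_p \le p^{ -k+1}$; moreover, either $|x|_p \le p^{ -k}$ or $x = p^{k-1}$. (iii) If $\varphi(x) = \varphi(y)$, then either $x = y$, or (after possibly interchanging $x$ and $y$) there exist an integer $k \ge 1$ and digits $a_0,\dots,a_{k-1} \in \{0,\dots,p-1\}$ with $a_{k-1} > 0$ such that $x = a_0 + a_1 p + \dots + a_{k-1}p^{k-1}$ and $y = a_0 + a_1 p + \dots + (a_{k-1}-1)p^{k-1} + \sum_{i=k}^\infty (p-1)p^i$.
   Context: $|\cdot|_p$ is the p-adic absolute value and $\mathbb{Z}_p$ the ring of p-adic integers; every $x \in \mathbb{Z}_p$ has a unique expansion $x = \sum_{i \ge 0} a_i p^i$ with digits $0 \le a_i \le p-1$. The Monna map $\varphi : \mathbb{Z}_p \to \mathbb{R}$ is defined by $\varphi\big(\sum_{i\ge0} a_i p^i\big) = \sum_{i\ge0} a_i p^{ -i-1}$, and $|\cdot|$ denotes the usual real absolute value. -}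

module Defs where

open import Data.Nat as ℕ using (ℕ; zero; suc; _^_; NonZero; _≤ᵇ_; _<ᵇ_; _≡ᵇ_; _∸_)
open import Data.Nat.Properties using (m*n≢0)
open import Data.Fin using (Fin; toℕ)
open import Data.Integer as ℤ using (ℤ; +_)
open import Data.Rational as ℚ using (ℚ; _/_; _-_; ∣_∣)
open import Data.Bool using (if_then_else_)
open import Data.Product using (∃; _×_)
open import Relation.Binary.PropositionalEquality using (_≡_)

pow-nz : ∀ p n → .{{_ : NonZero p}} → NonZero (p ^ n)
pow-nz p zero = _
pow-nz p (suc n) {{nz}} = m*n≢0 p (p ^ n) {{nz}} {{pow-nz p n {{nz}}}}

module Monna (p : ℕ) .{{p≢0 : NonZero p}} where

  -- A p-adic integer, given by its (unique) digit expansion x = Σ x(i) p^i.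
  ℤp : Set
  ℤp = ℕ → Fin p

  _≈_ : ℤp → ℤp → Set
  x ≈ y = ∀ i → x i ≡ y i

  -- |x|_p ≤ p^(-m)  (m ∈ ℤ):  p^m divides x, i.e. all digits of index < m vanish
  AbsLe : ℤp → ℤ → Set
  AbsLe x m = ∀ (i : ℕ) → (+ i) ℤ.< m → toℕ (x i) ≡ 0

  HasDigits : ℤp → (ℕ → ℕ) → Set
  HasDigits x d = ∀ i → toℕ (x i) ≡ d i

  -- numerator of the n-th partial sum of the Monna series:
  -- Σ_{i<n} x(i) p^{-i-1} = num n / p^n
  num : ℤp → ℕ → ℕ
  num x zero = 0
  num x (suc n) = num x n ℕ.* p ℕ.+ toℕ (x n)

  S : ℤp → ℕ → ℚ
  S x n = (+ num x n) / (p ^ n)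
    where instance _ = pow-nz p n

  pinv : ℕ → ℚ
  pinv k = (+ 1) / (p ^ k)
    where instance _ = pow-nz p k

  -- |φ(x)| ≤ q, where φ(x) is the real sum of the series (nonnegative terms,
  -- so the real limit is ≤ q iff every partial sum is)
  MonnaAbsLe : ℤp → ℚ → Set
  MonnaAbsLe x q = ∀ n → ∣ S x n ∣ ℚ.≤ q

  -- φ(x) = φ(y) as real numbers: the (Cauchy) sequences of partial sums
  -- are equivalent, i.e. their difference tends to 0
  MonnaEq : ℤp → ℤp → Set
  MonnaEq x y = ∀ (ε : ℚ) → ℚ.0ℚ ℚ.< ε →
    ∃ λ N → ∀ n → N ℕ.≤ n → ∣ S x n - S y n ∣ ℚ.≤ ε

  powDigits : ℕ → ℕ → ℕ
  powDigits j i = if i ≡ᵇ j then 1 else 0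

  finDigits : (ℕ → ℕ) → ℕ → ℕ → ℕ
  finDigits a m i = if i ≤ᵇ m then a i else 0

  tailDigits : (ℕ → ℕ) → ℕ → ℕ → ℕ
  tailDigits a m i =
    if i <ᵇ m then a i else (if i ≡ᵇ m then a m ∸ 1 else p ∸ 1)

  -- the exceptional configuration of (iii), with k = m + 1:
  -- x = a_0 + ... + a_{k-1} p^{k-1},
  -- y = a_0 + ... + (a_{k-1}-1) p^{k-1} + Σ_{i≥k} (p-1) p^i,
  -- digits a_i ∈ {0..p-1}, a_{k-1} > 0
  Exceptional : ℤp → ℤp → Set
  Exceptional x y = ∃ λ (m : ℕ) → ∃ λ (a : ℕ → ℕ) →
    (∀ i → i ℕ.≤ m → a i ℕ.< p) × 0 ℕ.< a m ×
    HasDigits x (finDigits a m) × HasDigits y (tailDigits a m)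

{-# OPTIONS --safe #-}
module Submission where

-- Write N_n(x) = num x n, so that S x n = N_n(x) / p^n, and split
-- N_{k+m}(x) = N_k(x) p^m + N_m(shift k x) with 0 ≤ N_m(shift k x) < p^m.
-- Then |φ(x)| ≤ p^-k says N_n(x) p^k ≤ p^n for every n. If the first k digits
-- vanish, N_{k+m}(x) < p^m gives this; conversely n = k gives N_k(x) ≤ 1, and
-- N_k(x) = 1 means x ≡ p^(k-1) mod p^k and leaves no room for further digits.
-- If φ(a) = φ(b), the numerators can never differ by 2: by the splitting, a gap
-- of 2 at level J grows beyond p^N at level J + N, so |S a - S b| > p^-J from
-- then on. At the first differing digit m this forces a_m = b_m + 1, and a gap
-- of exactly 1 survives each further step only if a's digit is 0 and b's is p - 1.

open import Defs
open import Data.Nat using (ℕ; zero; suc; _+_; _*_; _^_; _∸_; _≤_; _<_; _≤?_; _<?_; _≟_; z≤n; s≤s; NonZero; nonTrivial⇒n>1)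
open import Data.Nat.Properties
open import Data.Nat.Tactic.RingSolver using (solve-∀)
open import Data.Nat.Primality using (Prime; prime⇒nonZero; prime⇒nonTrivial)
open import Data.Fin using (toℕ)
open import Data.Fin.Properties using (toℕ<n; toℕ-injective)
import Data.Fin.Properties as Fin
open import Data.Integer using (+_; _-_)
import Data.Integer as ℤ
import Data.Integer.Properties as ℤ
import Data.Integer.Tactic.RingSolver as ℤ
open import Data.Rational using (_/_; ∣_∣; toℚᵘ)
import Data.Rational as ℚ
import Data.Rational.Properties as ℚ
open import Data.Rational.Unnormalised using (mkℚᵘ; *≤*; *≡*; _≃_)
import Data.Rational.Unnormalised as ℚᵘ
import Data.Rational.Unnormalised.Properties as ℚᵘ
open import Algebra.Properties.AbelianGroup ℚ.+-0-abelianGroup using (⁻¹-anti-homo‿-)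
open import Data.Bool.Properties using (if-cong)
open import Data.Product using (∃; _×_; _,_; proj₁; proj₂; map₂)
open import Data.Sum using (_⊎_; inj₁; inj₂; [_,_]′; fromInj₂)
open import Function.Bundles using (_⇔_; mk⇔; Equivalence)
open import Level using (0ℓ)
open import Axiom.ExcludedMiddle using (ExcludedMiddle)
open import Relation.Binary.PropositionalEquality
open import Relation.Binary.Definitions using (tri<; tri≈; tri>)
open import Relation.Nullary using (¬_; yes; no; contradiction)
open import Relation.Nullary.Decidable using (dec-true; dec-false; decidable-stable)
open import Relation.Unary using (Pred; Decidable)

open Equivalence using (to; from)

mkℚᵘ≤1/⇔ : ∀ c d e → mkℚᵘ (+ c) d ℚᵘ.≤ mkℚᵘ (+ 1) e ⇔ c * suc e ≤ suc d
mkℚᵘ≤1/⇔ c d e = mk⇔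
  (λ { (*≤* le) → ℤ.drop‿+≤+ (subst₂ ℤ._≤_ (sym (ℤ.pos-* c (suc e))) (ℤ.*-identityˡ (+ suc d)) le) })
  (λ le → *≤* (subst₂ ℤ._≤_ (ℤ.pos-* c (suc e)) (sym (ℤ.*-identityˡ (+ suc d))) (ℤ.+≤+ le)))

toℚᵘ-/ : ∀ c d → toℚᵘ (+ c / suc d) ≃ mkℚᵘ (+ c) d
toℚᵘ-/ c d = ℚ.toℚᵘ-fromℚᵘ (mkℚᵘ (+ c) d)

∣c/P∣≤1/E⇔c*E≤P : ∀ c P E .{{_ : NonZero P}} .{{_ : NonZero E}} →
                   ∣ + c / P ∣ ℚ.≤ + 1 / E ⇔ c * E ≤ P
∣c/P∣≤1/E⇔c*E≤P c (suc d) (suc e) = mk⇔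
  (λ le → to (mkℚᵘ≤1/⇔ c d e) (begin
     mkℚᵘ (+ c) d       ≃⟨ ∣c/P∣≃ ⟨
     toℚᵘ ∣ + c / suc d ∣ ≤⟨ ℚ.toℚᵘ-mono-≤ le ⟩
     toℚᵘ (+ 1 / suc e) ≃⟨ toℚᵘ-/ 1 e ⟩
     mkℚᵘ (+ 1) e       ∎))
  (λ le → ℚ.toℚᵘ-cancel-≤ (begin
     toℚᵘ ∣ + c / suc d ∣ ≃⟨ ∣c/P∣≃ ⟩
     mkℚᵘ (+ c) d       ≤⟨ from (mkℚᵘ≤1/⇔ c d e) le ⟩
     mkℚᵘ (+ 1) e       ≃⟨ toℚᵘ-/ 1 e ⟨
     toℚᵘ (+ 1 / suc e) ∎))
  where
  open ℚᵘ.≤-Reasoning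
  ∣c/P∣≃ : toℚᵘ ∣ + c / suc d ∣ ≃ mkℚᵘ (+ c) d
  ∣c/P∣≃ = ℚᵘ.≃-trans (ℚ.toℚᵘ-homo-∣-∣ (+ c / suc d)) (ℚᵘ.∣-∣-cong (toℚᵘ-/ c d))

[m+n]/d-m/d≃n/d : ∀ m n d → mkℚᵘ (m ℤ.+ n) d ℚᵘ.- mkℚᵘ m d ≃ mkℚᵘ n d
[m+n]/d-m/d≃n/d m n d = *≡* (begin
  ((m ℤ.+ n) ℤ.* D ℤ.+ ℤ.- m ℤ.* D) ℤ.* D ≡⟨ cancel m n D ⟩
  n ℤ.* (D ℤ.* D)                        ≡⟨ cong (n ℤ.*_) (ℤ.pos-* (suc d) (suc d)) ⟨
  n ℤ.* + (suc d * suc d)                ∎)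
  where
  open ≡-Reasoning
  D = + suc d
  cancel : ∀ m n D → ((m ℤ.+ n) ℤ.* D ℤ.+ ℤ.- m ℤ.* D) ℤ.* D ≡ n ℤ.* (D ℤ.* D)
  cancel = ℤ.solve-∀

[c+t]/P-c/P≡t/P : ∀ c t P .{{_ : NonZero P}} → + (c + t) / P ℚ.- + c / P ≡ + t / P
[c+t]/P-c/P≡t/P c t (suc d) = ℚ.toℚᵘ-injective (begin
  toℚᵘ (+ (c + t) / suc d ℚ.- + c / suc d)
    ≈⟨ ℚ.toℚᵘ-homo-+ (+ (c + t) / suc d) (ℚ.- (+ c / suc d)) ⟩
  toℚᵘ (+ (c + t) / suc d) ℚᵘ.+ toℚᵘ (ℚ.- (+ c / suc d))
    ≈⟨ ℚᵘ.+-cong (toℚᵘ-/ (c + t) d) (ℚᵘ.≃-trans (ℚ.toℚᵘ-homo‿- (+ c / suc d)) (ℚᵘ.-‿cong (toℚᵘ-/ c d))) ⟩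
  mkℚᵘ (+ (c + t)) d ℚᵘ.- mkℚᵘ (+ c) d
    ≡⟨ cong (λ z → mkℚᵘ z d ℚᵘ.- mkℚᵘ (+ c) d) (ℤ.pos-+ c t) ⟩
  mkℚᵘ (+ c ℤ.+ + t) d ℚᵘ.- mkℚᵘ (+ c) d
    ≈⟨ [m+n]/d-m/d≃n/d (+ c) (+ t) d ⟩
  mkℚᵘ (+ t) d
    ≈⟨ toℚᵘ-/ t d ⟨
  toℚᵘ (+ t / suc d) ∎)
  where open ℚᵘ.≃-Reasoning

∣c/P-d/P∣≤1/E⇒[c∸d]*E≤P : ∀ c d P E .{{_ : NonZero P}} .{{_ : NonZero E}} → d ≤ c →
                          ∣ + c / P ℚ.- + d / P ∣ ℚ.≤ + 1 / E → (c ∸ d) * E ≤ P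
∣c/P-d/P∣≤1/E⇒[c∸d]*E≤P c d P E d≤c close with m≤n⇒∃[o]m+o≡n d≤c
... | t , refl rewrite m+n∸m≡n d t =
  to (∣c/P∣≤1/E⇔c*E≤P t P E) (subst (λ q → ∣ q ∣ ℚ.≤ + 1 / E) ([c+t]/P-c/P≡t/P d t P) close)

∣p-q∣≡∣q-p∣ : ∀ p q → ∣ p ℚ.- q ∣ ≡ ∣ q ℚ.- p ∣
∣p-q∣≡∣q-p∣ p q = trans (sym (ℚ.∣-p∣≡∣p∣ (p ℚ.- q))) (cong ∣_∣ (⁻¹-anti-homo‿- p q))

least-counterexample : ∀ {ℓ} {P : Pred ℕ ℓ} → Decidable P → ∀ {n} → ¬ P n →
                       ∃ λ m → (∀ j → j < m → P j) × ¬ P m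
least-counterexample {P = P} P? {n} ¬Pn =
  fromInj₂ (λ all → contradiction (all n ≤-refl) ¬Pn) (search (suc n))
  where
  search : ∀ n → (∀ j → j < n → P j) ⊎ ∃ λ m → (∀ j → j < m → P j) × ¬ P m
  search zero = inj₁ λ _ ()
  search (suc n) with search n
  ... | inj₂ found = inj₂ found
  ... | inj₁ below with P? n
  ...   | yes Pn = inj₁ λ j j<1+n → [ below j , (λ { refl → Pn }) ]′ (m<1+n⇒m<n∨m≡n j<1+n)
  ...   | no ¬Pn = inj₂ (n , below , ¬Pn)

module MonnaProperties (p : ℕ) .{{_ : NonZero p}} where
  open Monna p

  shift : ℕ → ℤp → ℤp
  shift k x i = x (k + i)

  num<p^n : ∀ x n → num x n < p ^ n
  num<p^n x zero = s≤s z≤n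
  num<p^n x (suc n) = begin-strict
    num x n * p + toℕ (x n) <⟨ +-monoʳ-< (num x n * p) (toℕ<n (x n)) ⟩
    num x n * p + p         ≡⟨ +-comm (num x n * p) p ⟩
    suc (num x n) * p       ≤⟨ *-monoˡ-≤ p (num<p^n x n) ⟩
    p ^ n * p               ≡⟨ *-comm (p ^ n) p ⟩
    p ^ suc n               ∎
    where open ≤-Reasoning

  num-+ : ∀ x k m → num x (k + m) ≡ num x k * p ^ m + num (shift k x) m
  num-+ x k zero = begin
    num x (k + 0)   ≡⟨ cong (num x) (+-identityʳ k) ⟩
    num x k         ≡⟨ *-identityʳ (num x k) ⟨
    num x k * 1     ≡⟨ +-identityʳ (num x k * 1) ⟨
    num x k * 1 + 0 ∎
    where open ≡-Reasoning
  num-+ x k (suc m) = begin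
    num x (k + suc m)                 ≡⟨ cong (num x) (+-suc k m) ⟩
    num x (k + m) * p + d             ≡⟨ cong (λ c → c * p + d) (num-+ x k m) ⟩
    (num x k * p ^ m + r) * p + d     ≡⟨ regroup (num x k) r d (p ^ m) p ⟩
    num x k * (p * p ^ m) + (r * p + d) ∎
    where
    open ≡-Reasoning
    r = num (shift k x) m
    d = toℕ (x (k + m))
    regroup : ∀ a r d q p → (a * q + r) * p + d ≡ a * (p * q) + (r * p + d)
    regroup = solve-∀

  AbsLe-weaken : ∀ {x m n} → m ℤ.≤ n → AbsLe x n → AbsLe x m
  AbsLe-weaken m≤n x≤n i i<m = x≤n i (ℤ.<-≤-trans i<m m≤n)

  num≡0⇒AbsLe : ∀ x n → num x n ≡ 0 → AbsLe x (+ n)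
  num≡0⇒AbsLe x (suc n) eq i (ℤ.+<+ i<1+n) with m<1+n⇒m<n∨m≡n i<1+n
  ... | inj₁ i<n  = num≡0⇒AbsLe x n (m*n≡0⇒m≡0 (num x n) p (m+n≡0⇒m≡0 (num x n * p) eq)) i (ℤ.+<+ i<n)
  ... | inj₂ refl = m+n≡0⇒n≡0 (num x n * p) eq

  AbsLe⇒num≡0 : ∀ x n → AbsLe x (+ n) → num x n ≡ 0
  AbsLe⇒num≡0 x zero    _   = refl
  AbsLe⇒num≡0 x (suc n) x≤n
    rewrite AbsLe⇒num≡0 x n (AbsLe-weaken (ℤ.+≤+ (n≤1+n n)) x≤n) | x≤n n (ℤ.+<+ ≤-refl) = refl

  MonnaAbsLe⇔num*p^k≤p^n : ∀ x k → MonnaAbsLe x (pinv k) ⇔ (∀ n → num x n * p ^ k ≤ p ^ n)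
  MonnaAbsLe⇔num*p^k≤p^n x k = mk⇔
    (λ x≤k n → to (pointwise n) (x≤k n))
    (λ bound n → from (pointwise n) (bound n))
    where
    pointwise : ∀ n → ∣ S x n ∣ ℚ.≤ pinv k ⇔ num x n * p ^ k ≤ p ^ n
    pointwise n = ∣c/P∣≤1/E⇔c*E≤P (num x n) (p ^ n) (p ^ k) {{m^n≢0 p n}} {{m^n≢0 p k}}

  AbsLe⇒num*p^k≤p^n : ∀ x k → AbsLe x (+ k) → ∀ n → num x n * p ^ k ≤ p ^ n
  AbsLe⇒num*p^k≤p^n x k x≤k n with ≤-total n k
  ... | inj₁ n≤k rewrite AbsLe⇒num≡0 x n (AbsLe-weaken (ℤ.+≤+ n≤k) x≤k) = z≤n
  ... | inj₂ k≤n with m≤n⇒∃[o]m+o≡n k≤n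
  ...   | m , refl = begin
    num x (k + m) * p ^ k                          ≡⟨ cong (_* p ^ k) (num-+ x k m) ⟩
    (num x k * p ^ m + num (shift k x) m) * p ^ k  ≡⟨ cong (λ c → (c * p ^ m + num (shift k x) m) * p ^ k) (AbsLe⇒num≡0 x k x≤k) ⟩
    num (shift k x) m * p ^ k                      ≤⟨ *-monoˡ-≤ (p ^ k) (<⇒≤ (num<p^n (shift k x) m)) ⟩
    p ^ m * p ^ k                                  ≡⟨ *-comm (p ^ m) (p ^ k) ⟩
    p ^ k * p ^ m                                  ≡⟨ ^-distribˡ-+-* p k m ⟨
    p ^ (k + m)                                    ∎
    where open ≤-Reasoning

  AbsLe⇒MonnaAbsLe : ∀ x k → AbsLe x (+ k) → MonnaAbsLe x (pinv k)
  AbsLe⇒MonnaAbsLe x k x≤k = from (MonnaAbsLe⇔num*p^k≤p^n x k) (AbsLe⇒num*p^k≤p^n x k x≤k)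

  MonnaAbsLe⇒num≤1 : ∀ x k → MonnaAbsLe x (pinv k) → num x k ≤ 1
  MonnaAbsLe⇒num≤1 x k x≤k = *-cancelʳ-≤ (num x k) 1 (p ^ k) {{m^n≢0 p k}} (begin
    num x k * p ^ k ≤⟨ to (MonnaAbsLe⇔num*p^k≤p^n x k) x≤k k ⟩
    p ^ k           ≡⟨ *-identityˡ (p ^ k) ⟨
    1 * p ^ k       ∎)
    where open ≤-Reasoning

  MonnaAbsLe∧num≡1⇒shift≡0 : ∀ x k → MonnaAbsLe x (pinv k) → num x k ≡ 1 →
                             ∀ m → num (shift k x) m ≡ 0
  MonnaAbsLe∧num≡1⇒shift≡0 x k x≤k num≡1 m =
    n≤0⇒n≡0 (+-cancelˡ-≤ (p ^ m) (num (shift k x) m) 0 (*-cancelʳ-≤ _ _ (p ^ k) {{m^n≢0 p k}} (begin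
      (p ^ m + num (shift k x) m) * p ^ k            ≡⟨ cong (λ c → (c + num (shift k x) m) * p ^ k) (*-identityˡ (p ^ m)) ⟨
      (1 * p ^ m + num (shift k x) m) * p ^ k        ≡⟨ cong (λ c → (c * p ^ m + num (shift k x) m) * p ^ k) num≡1 ⟨
      (num x k * p ^ m + num (shift k x) m) * p ^ k  ≡⟨ cong (_* p ^ k) (num-+ x k m) ⟨
      num x (k + m) * p ^ k                          ≤⟨ to (MonnaAbsLe⇔num*p^k≤p^n x k) x≤k (k + m) ⟩
      p ^ (k + m)                                    ≡⟨ ^-distribˡ-+-* p k m ⟩
      p ^ k * p ^ m                                  ≡⟨ *-comm (p ^ k) (p ^ m) ⟩
      p ^ m * p ^ k                                  ≡⟨ cong (_* p ^ k) (+-identityʳ (p ^ m)) ⟨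
      (p ^ m + 0) * p ^ k                            ∎)))
    where open ≤-Reasoning

  module _ (1<p : 1 < p) where

    m*p+n≡1⇒m≡0 : ∀ m n → m * p + n ≡ 1 → m ≡ 0
    m*p+n≡1⇒m≡0 zero    n _  = refl
    m*p+n≡1⇒m≡0 (suc m) n eq =
      contradiction (m+n≤o⇒m≤o p (≤-reflexive (trans (sym (+-assoc p (m * p) n)) eq))) (<⇒≱ 1<p)

    MonnaAbsLe∧num≡1⇒powDigits : ∀ x k → MonnaAbsLe x (pinv k) → num x k ≡ 1 →
                                 ∃ λ j → k ≡ suc j × num x j ≡ 0 × HasDigits x (powDigits j)
    MonnaAbsLe∧num≡1⇒powDigits x (suc j) x≤k num≡1 = j , refl , below≡0 , digits
      where
      below≡0 : num x j ≡ 0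
      below≡0 = m*p+n≡1⇒m≡0 (num x j) (toℕ (x j)) num≡1
      xj≡1 : toℕ (x j) ≡ 1
      xj≡1 = trans (cong (λ c → c * p + toℕ (x j)) (sym below≡0)) num≡1
      beyond≡0 : ∀ o → toℕ (x (suc j + o)) ≡ 0
      beyond≡0 o = num≡0⇒AbsLe (shift (suc j) x) (suc o)
                     (MonnaAbsLe∧num≡1⇒shift≡0 x (suc j) x≤k num≡1 (suc o)) o (ℤ.+<+ ≤-refl)
      -- does (i ≟ j) computes to i ≡ᵇ j, so dec-true and dec-false decide the
      -- conditionals in powDigits (and likewise in finDigits and tailDigits).
      digits : HasDigits x (powDigits j)
      digits i with <-cmp i j
      ... | tri< i<j i≢j _ = trans (num≡0⇒AbsLe x j below≡0 i (ℤ.+<+ i<j)) (sym (if-cong (dec-false (i ≟ j) i≢j)))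
      ... | tri≈ _ refl _  = trans xj≡1 (sym (if-cong (dec-true (i ≟ i) refl)))
      ... | tri> _ i≢j j<i with m≤n⇒∃[o]m+o≡n j<i
      ...   | o , refl = trans (beyond≡0 o) (sym (if-cong (dec-false (suc j + o ≟ j) i≢j)))

    MonnaAbsLe⇒AbsLe : ∀ x k → MonnaAbsLe x (pinv k) →
                       AbsLe x (+ k - + 1) × (AbsLe x (+ k) ⊎ ∃ λ j → k ≡ suc j × HasDigits x (powDigits j))
    MonnaAbsLe⇒AbsLe x k x≤k with m≤n⇒m<n∨m≡n (MonnaAbsLe⇒num≤1 x k x≤k)
    ... | inj₁ num<1 = AbsLe-weaken (ℤ.i-j≤i (+ k) (+ 1)) ∣x∣≤p^-k , inj₁ ∣x∣≤p^-k
      where ∣x∣≤p^-k = num≡0⇒AbsLe x k (n<1⇒n≡0 num<1)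
    ... | inj₂ num≡1 with MonnaAbsLe∧num≡1⇒powDigits x k x≤k num≡1
    ...   | j , refl , below≡0 , digits = num≡0⇒AbsLe x j below≡0 , inj₂ (j , refl , digits)

  agree⇒num≡ : ∀ {x y m} → (∀ j → j < m → x j ≡ y j) → num x m ≡ num y m
  agree⇒num≡ {m = zero}  _     = refl
  agree⇒num≡ {m = suc m} agree =
    cong₂ (λ c d → c * p + toℕ d) (agree⇒num≡ λ j j<m → agree j (m<n⇒m<1+n j<m)) (agree m ≤-refl)

  MonnaEq-sym : ∀ {x y} → MonnaEq x y → MonnaEq y x
  MonnaEq-sym {x} {y} x≃y ε ε>0 =
    map₂ (λ close n N≤n → subst (ℚ._≤ ε) (∣p-q∣≡∣q-p∣ (S x n) (S y n)) (close n N≤n)) (x≃y ε ε>0)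

  MonnaEq⇒[num∸num]*p^J≤p^n : ∀ {x y} → MonnaEq x y → ∀ J → ∃ λ N → ∀ n → N ≤ n →
                               num y n ≤ num x n → (num x n ∸ num y n) * p ^ J ≤ p ^ n
  MonnaEq⇒[num∸num]*p^J≤p^n {x} {y} x≃y J =
    map₂ (λ close n N≤n y≤x → ∣c/P-d/P∣≤1/E⇒[c∸d]*E≤P (num x n) (num y n) (p ^ n) (p ^ J)
                                {{m^n≢0 p n}} {{m^n≢0 p J}} y≤x (close n N≤n))
         (x≃y (pinv J) (ℚ.positive⁻¹ (pinv J) {{ℚ.normalize-pos 1 (p ^ J) {{m^n≢0 p J}}}}))

  2+num≤num⇒1+p^N+num≤num : ∀ x y J → 2 + num y J ≤ num x J →
                            ∀ N → suc (p ^ N) + num y (J + N) ≤ num x (J + N)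
  2+num≤num⇒1+p^N+num≤num x y J gap N = begin
    suc (p ^ N) + num y (J + N)                        ≡⟨ cong (λ c → suc (p ^ N) + c) (num-+ y J N) ⟩
    suc (p ^ N) + (num y J * p ^ N + num (shift J y) N) ≡⟨ regroup (p ^ N) (num y J * p ^ N) (num (shift J y) N) ⟩
    p ^ N + num y J * p ^ N + suc (num (shift J y) N) ≤⟨ +-monoʳ-≤ (p ^ N + num y J * p ^ N) (num<p^n (shift J y) N) ⟩
    p ^ N + num y J * p ^ N + p ^ N                   ≡⟨ collect (p ^ N) (num y J) ⟩
    (2 + num y J) * p ^ N                             ≤⟨ *-monoˡ-≤ (p ^ N) gap ⟩
    num x J * p ^ N                                   ≤⟨ m≤m+n (num x J * p ^ N) (num (shift J x) N) ⟩
    num x J * p ^ N + num (shift J x) N               ≡⟨ num-+ x J N ⟨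
    num x (J + N)                                     ∎
    where
    open ≤-Reasoning
    regroup : ∀ q a r → suc q + (a + r) ≡ q + a + suc r
    regroup = solve-∀
    collect : ∀ q a → q + a * q + q ≡ (2 + a) * q
    collect = solve-∀

  MonnaEq⇒num≤1+num : ∀ {x y} → MonnaEq x y → ∀ n → num x n ≤ suc (num y n)
  MonnaEq⇒num≤1+num {x} {y} x≃y J = ≮⇒≥ λ gap → 1+n≰n (too-far gap)
    where
    N = proj₁ (MonnaEq⇒[num∸num]*p^J≤p^n x≃y J)
    n = J + N
    too-far : 2 + num y J ≤ num x J → suc (p ^ N) ≤ p ^ N
    too-far gap = *-cancelʳ-≤ (suc (p ^ N)) (p ^ N) (p ^ J) {{m^n≢0 p J}} (begin
      suc (p ^ N) * p ^ J           ≤⟨ *-monoˡ-≤ (p ^ J) (m+n≤o⇒m≤o∸n (suc (p ^ N)) grown) ⟩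
      (num x n ∸ num y n) * p ^ J   ≤⟨ proj₂ (MonnaEq⇒[num∸num]*p^J≤p^n x≃y J) n (m≤n+m N J) (m+n≤o⇒n≤o (suc (p ^ N)) grown) ⟩
      p ^ (J + N)                   ≡⟨ ^-distribˡ-+-* p J N ⟩
      p ^ J * p ^ N                 ≡⟨ *-comm (p ^ J) (p ^ N) ⟩
      p ^ N * p ^ J                 ∎)
      where
      open ≤-Reasoning
      grown = 2+num≤num⇒1+p^N+num≤num x y J gap N

  module _ {a b : ℤp} (a≃b : MonnaEq a b) where

    next-digit-bound : ∀ n g → num a n ≡ g + num b n → g * p + toℕ (a n) ≤ suc (toℕ (b n))
    next-digit-bound n g eq = +-cancelˡ-≤ (num b n * p) _ _ (begin
      num b n * p + (g * p + α) ≡⟨ regroup (num b n) g α p ⟩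
      (g + num b n) * p + α     ≡⟨ cong (λ c → c * p + α) eq ⟨
      num a (suc n)             ≤⟨ MonnaEq⇒num≤1+num a≃b (suc n) ⟩
      suc (num b n * p + β)     ≡⟨ +-suc (num b n * p) β ⟨
      num b n * p + suc β       ∎)
      where
      open ≤-Reasoning
      α = toℕ (a n)
      β = toℕ (b n)
      regroup : ∀ B g α p → B * p + (g * p + α) ≡ (g + B) * p + α
      regroup = solve-∀

    carry-propagates : ∀ n → num a n ≡ suc (num b n) →
                       toℕ (a n) ≡ 0 × suc (toℕ (b n)) ≡ p × num a (suc n) ≡ suc (num b (suc n))
    carry-propagates n eq = α≡0 , 1+β≡p , (begin
      num a n * p + α           ≡⟨ cong₂ (λ c d → c * p + d) eq α≡0 ⟩
      suc (num b n) * p + 0     ≡⟨ +-identityʳ (suc (num b n) * p) ⟩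
      p + num b n * p           ≡⟨ +-comm p (num b n * p) ⟩
      num b n * p + p           ≡⟨ cong (λ c → num b n * p + c) 1+β≡p ⟨
      num b n * p + suc β       ≡⟨ +-suc (num b n * p) β ⟩
      suc (num b n * p + β)     ∎)
      where
      open ≡-Reasoning
      α = toℕ (a n)
      β = toℕ (b n)
      p+α≤1+β : p + α ≤ suc β
      p+α≤1+β = subst (λ c → c + α ≤ suc β) (*-identityˡ p) (next-digit-bound n 1 eq)
      α≡0 : α ≡ 0
      α≡0 = n≤0⇒n≡0 (+-cancelˡ-≤ p α 0 (≤-trans p+α≤1+β (≤-trans (toℕ<n (b n)) (≤-reflexive (sym (+-identityʳ p))))))
      1+β≡p : suc β ≡ p
      1+β≡p = ≤-antisym (toℕ<n (b n)) (m+n≤o⇒m≤o p p+α≤1+β)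

    module _ {m} (agree : ∀ j → j < m → a j ≡ b j) (b<a : toℕ (b m) < toℕ (a m)) where

      aₘ≡1+bₘ : toℕ (a m) ≡ suc (toℕ (b m))
      aₘ≡1+bₘ = ≤-antisym (next-digit-bound m 0 (agree⇒num≡ agree)) b<a

      carry-after-m : ∀ i → num a (suc m + i) ≡ suc (num b (suc m + i))
      carry-after-m zero rewrite +-identityʳ m = begin
        num a m * p + toℕ (a m)        ≡⟨ cong₂ (λ c d → c * p + d) (agree⇒num≡ agree) aₘ≡1+bₘ ⟩
        num b m * p + suc (toℕ (b m))  ≡⟨ +-suc (num b m * p) (toℕ (b m)) ⟩
        suc (num b m * p + toℕ (b m))  ∎
        where open ≡-Reasoning
      carry-after-m (suc i) rewrite +-suc m i = proj₂ (proj₂ (carry-propagates (suc m + i) (carry-after-m i)))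

      exceptional : Exceptional a b
      exceptional = m , (λ i → toℕ (a i)) , (λ i _ → toℕ<n (a i)) , ≤-<-trans z≤n b<a , a-digits , b-digits
        where
        beyond : ∀ o → toℕ (a (suc m + o)) ≡ 0 × suc (toℕ (b (suc m + o))) ≡ p
        beyond o = map₂ proj₁ (carry-propagates (suc m + o) (carry-after-m o))
        a-digits : HasDigits a (finDigits (λ i → toℕ (a i)) m)
        a-digits i with i ≤? m
        ... | yes i≤m = sym (if-cong (dec-true (i ≤? m) i≤m))
        ... | no i≰m with m≤n⇒∃[o]m+o≡n (≰⇒> i≰m)
        ...   | o , refl = trans (proj₁ (beyond o)) (sym (if-cong (dec-false (suc m + o ≤? m) i≰m)))
        b-digits : HasDigits b (tailDigits (λ i → toℕ (a i)) m)
        b-digits i with <-cmp i m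
        ... | tri< i<m _ _ = trans (cong toℕ (sym (agree i i<m))) (sym (if-cong (dec-true (i <? m) i<m)))
        ... | tri≈ i≮m refl _ =
          trans (cong (_∸ 1) (sym aₘ≡1+bₘ))
                (sym (trans (if-cong (dec-false (i <? i) i≮m)) (if-cong (dec-true (i ≟ i) refl))))
        ... | tri> i≮m i≢m m<i with m≤n⇒∃[o]m+o≡n m<i
        ...   | o , refl =
          trans (cong (_∸ 1) (proj₂ (beyond o)))
                (sym (trans (if-cong (dec-false (suc m + o <? m) i≮m)) (if-cong (dec-false (suc m + o ≟ m) i≢m))))

  MonnaEq⇒≈⊎Exceptional : ExcludedMiddle 0ℓ → ∀ x y → MonnaEq x y → x ≈ y ⊎ Exceptional x y ⊎ Exceptional y x
  MonnaEq⇒≈⊎Exceptional em x y x≃y with em {∃ λ i → x i ≢ y i}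
  ... | no ∄i = inj₁ λ i → decidable-stable (x i Fin.≟ y i) λ x≢y → ∄i (i , x≢y)
  ... | yes (_ , x≢y) with least-counterexample (λ j → x j Fin.≟ y j) x≢y
  ...   | m , agree , xm≢ym with <-cmp (toℕ (y m)) (toℕ (x m))
  ...     | tri< y<x _ _ = inj₂ (inj₁ (exceptional x≃y agree y<x))
  ...     | tri≈ _ eq _  = contradiction (toℕ-injective (sym eq)) xm≢ym
  ...     | tri> _ _ x<y = inj₂ (inj₂ (exceptional (MonnaEq-sym x≃y) (λ j j<m → sym (agree j j<m)) x<y))

lemma2p1 : (p : ℕ) (pr : Prime p) →
    let open Monna p {{prime⇒nonZero pr}} in
    -- (i)
    (∀ (x : ℤp) (k : ℕ) → AbsLe x (+ k) → MonnaAbsLe x (pinv k))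
    -- (ii)
    × (∀ (x : ℤp) (k : ℕ) → MonnaAbsLe x (pinv k) →
        AbsLe x (+ k - + 1)
        × (AbsLe x (+ k) ⊎ (∃ λ j → k ≡ suc j × HasDigits x (powDigits j))))
    -- (iii)  (classical statement: excluded middle assumed)
    × (ExcludedMiddle 0ℓ → ∀ (x y : ℤp) → MonnaEq x y →
        x ≈ y ⊎ Exceptional x y ⊎ Exceptional y x)
lemma2p1 p pr = AbsLe⇒MonnaAbsLe , MonnaAbsLe⇒AbsLe 1<p , MonnaEq⇒≈⊎Exceptional
  where
  open MonnaProperties p {{prime⇒nonZero pr}}
  1<p : 1 < p
  1<p = nonTrivial⇒n>1 p {{prime⇒nonTrivial pr}}
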